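{- (1) If $\preceq$ is a quasi-linear believability relation and $\preceq_{c}$ is constructed from $\preceq$ by: $A \preceq_{c} B$ iff $B = \emptyset$ or there exists $\varphi \in A$ such that $\varphi \preceq \psi$ for every $\psi \in B$, then $\preceq_{c}$ is a standard multi-believability relation, and $\preceq$ can be retrieved from $\preceq_{c}$ by: $\varphi \preceq \psi$ iff $\{\varphi\} \preceq_{c} \{\psi\}$. (2) If $\preceq_{c}$ is a standard multi-believability relation and $\preceq$ is constructed from $\preceq_{c}$ by: $\varphi \preceq \psi$ iff $\{\varphi\} \preceq_{c} \{\psi\}$, then $\preceq$ is a quasi-linear believability relation, and $\preceq_{c}$ can be retrieved from $\preceq$ by: $A \preceq_{c} B$ iff $B = \emptyset$ or there exists $\varphi \in A$ such that $\varphi \preceq \psi$ for every $\psi \in B$.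
   Context: $\mathcal{L}$ is a propositional language with consequence operation $\mathrm{Cn}$ (supraclassical, compact, deduction property); $X\vdash\varphi$ means $\varphi\in\mathrm{Cn}(X)$; $\bot$ is a contradiction. $K$ is a fixed consistent belief set ($K=\mathrm{Cn}(K)$). $A \equiv B$ means every element of $A$ is logically equivalent to some element of $B$ and vice versa. A believability relation $\preceq$ is a binary relation on $\mathcal{L}$ (symmetric part $\simeq$). It is quasi-linear iff it satisfies: transitivity; coupling (if $\varphi \simeq \psi$ then $\varphi \simeq \varphi\wedge\psi$); weak coupling (if $\varphi\simeq\varphi\wedge\psi$ and $\varphi\simeq\varphi\wedge\lambda$ then $\varphi\simeq\varphi\wedge(\psi\wedge\lambda)$); counter dominance (if $\varphi\vdash\psi$ then $\psi\preceq\varphi$); minimality ($\varphi\in K$ iff $\varphi\preceq\psi$ for all $\psi$); maximality (if $\psi\preceq\varphi$ for all $\psi$ then $\varphi$ is logically equivalent to $\bot$); completeness ($\varphi\preceq\psi$ or $\psi\preceq\varphi$). A multi-believability relation $\preceq_{c}$ is a binary relation on finite subsets of $\mathcal{L}$ (symmetric part $\simeq_{c}$, strict part $\prec_{c}$; $\{\varphi\}$ written $\varphi$). It is standard iff it satisfies, for all finite $A,B,C$: transitivity; weak coupling (if $A \simeq_{c} \{\varphi\wedge\psi\mid\varphi\in A,\psi\in B\}$ and $A \simeq_{c} \{\varphi\wedge\chi\mid\varphi\in A,\chi\in C\}$ then $A\simeq_{c}\{(\varphi\wedge\psi)\wedge\chi\mid\varphi\in A,\psi\in B,\chi\in C\}$);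 coupling (if $A\simeq_{c}B$ then $A\simeq_{c}\{\varphi\wedge\psi\mid\varphi\in A,\psi\in B\}$); counter dominance (if for every $\varphi\in B$ there is $\psi\in A$ with $\varphi\vdash\psi$ then $A\preceq_{c}B$); minimality ($A\preceq_{c}B$ for all $B$ iff $A\cap K\neq\emptyset$); maximality (if $B$ is non-empty and $A\preceq_{c}B$ for all non-empty $A$ then $B\equiv\{\bot\}$); completeness ($A\preceq_{c}B$ or $B\preceq_{c}A$); determination ($A\prec_{c}\emptyset$ for every non-empty $A$); union ($A\preceq_{c}A\cup B$ or $B\preceq_{c}A\cup B$). -}

module Defs where

open import Level using (0ℓ)
open import Data.Nat using (ℕ)
open import Data.Bool using (Bool; true; false; _∧_; _∨_; not)
open import Data.List using (List; []; _∷_; map; concatMap; _++_)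
open import Data.List.Membership.Propositional using (_∈_)
open import Data.List.Relation.Unary.All using (All)
open import Data.Product using (Σ; ∃; _×_; _,_)
open import Data.Sum using (_⊎_)
open import Relation.Nullary using (¬_)
open import Relation.Unary using (Pred; _⊆_; _∪_; ｛_｝)
open import Relation.Binary.PropositionalEquality using (_≡_)
open import Function.Bundles using (_⇔_)

infixr 6 _∧'_
infixr 5 _∨'_
infixr 4 _⇒'_

data Form : Set where
  var  : ℕ → Form
  ⊥'   : Form
  ¬'_  : Form → Form
  _∧'_ : Form → Form → Form
  _∨'_ : Form → Form → Form
  _⇒'_ : Form → Form → Form

eval : (ℕ → Bool) → Form → Bool
eval v (var n)  = v n
eval v ⊥'       = false
eval v (¬' φ)   = not (eval v φ)
eval v (φ ∧' ψ) = eval v φ ∧ eval v ψ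
eval v (φ ∨' ψ) = eval v φ ∨ eval v ψ
eval v (φ ⇒' ψ) = not (eval v φ) ∨ eval v ψ

_⊨_ : Pred Form 0ℓ → Form → Set
X ⊨ φ = ∀ (v : ℕ → Bool) → (∀ ψ → X ψ → eval v ψ ≡ true) → eval v φ ≡ true

⟦_⟧ : List Form → Pred Form 0ℓ
⟦ xs ⟧ φ = φ ∈ xs

record Consequence : Set₁ where
  field
    Cn          : Pred Form 0ℓ → Pred Form 0ℓ
    inclusion   : ∀ X → X ⊆ Cn X
    monotony    : ∀ X Y → X ⊆ Y → Cn X ⊆ Cn Y
    iteration   : ∀ X → Cn (Cn X) ⊆ Cn X
    supraclassical : ∀ X φ → X ⊨ φ → Cn X φ
    compact     : ∀ X φ → Cn X φ →
                  Σ (List Form) λ ys → (⟦ ys ⟧ ⊆ X) × Cn ⟦ ys ⟧ φ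
    deduction   : ∀ X φ ψ → Cn (X ∪ ｛ φ ｝) ψ ⇔ Cn X (φ ⇒' ψ)

module _ (C : Consequence) where
  open Consequence C

  _⊢_ : Pred Form 0ℓ → Form → Set
  X ⊢ φ = Cn X φ

  _⊢₁_ : Form → Form → Set
  φ ⊢₁ ψ = ｛ φ ｝ ⊢ ψ

  _≡ₗ_ : Form → Form → Set
  φ ≡ₗ ψ = (φ ⊢₁ ψ) × (ψ ⊢₁ φ)

  _≡ₛ_ : List Form → List Form → Set
  A ≡ₛ B = (∀ φ → φ ∈ A → ∃ λ ψ → ψ ∈ B × φ ≡ₗ ψ)
         × (∀ ψ → ψ ∈ B → ∃ λ φ → φ ∈ A × φ ≡ₗ ψ)

  record ConsistentBeliefSet (K : Pred Form 0ℓ) : Set where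
    field
      closed     : Cn K ⊆ K
      consistent : ¬ (K ⊢ ⊥')

Rel₁ : Set₁
Rel₁ = Form → Form → Set

module _ (C : Consequence) (K : Pred Form 0ℓ) where

  record QuasiLinear (_≼_ : Rel₁) : Set where
    _≃_ : Form → Form → Set
    φ ≃ ψ = (φ ≼ ψ) × (ψ ≼ φ)
    field
      transitivity     : ∀ φ ψ λ' → φ ≼ ψ → ψ ≼ λ' → φ ≼ λ'
      coupling         : ∀ φ ψ → φ ≃ ψ → φ ≃ (φ ∧' ψ)
      weakCoupling     : ∀ φ ψ λ' → φ ≃ (φ ∧' ψ) → φ ≃ (φ ∧' λ') →
                         φ ≃ (φ ∧' (ψ ∧' λ'))
      counterDominance : ∀ φ ψ → _⊢₁_ C φ ψ → ψ ≼ φ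
      minimality       : ∀ φ → K φ ⇔ (∀ ψ → φ ≼ ψ)
      maximality       : ∀ φ → (∀ ψ → ψ ≼ φ) → _≡ₗ_ C φ ⊥'
      completeness     : ∀ φ ψ → (φ ≼ ψ) ⊎ (ψ ≼ φ)

-- Multi-believability relations on finite subsets of L,
-- finite subsets being represented by lists.

RelC : Set₁
RelC = List Form → List Form → Set

_≈ₛ_ : List Form → List Form → Set
A ≈ₛ B = ∀ φ → (φ ∈ A) ⇔ (φ ∈ B)

OnFiniteSets : RelC → Set
OnFiniteSets R = ∀ A A' B B' → A ≈ₛ A' → B ≈ₛ B' → R A B → R A' B'

conj : List Form → List Form → List Form
conj A B = concatMap (λ φ → map (λ ψ → φ ∧' ψ) B) A

NonEmpty : List Form → Set
NonEmpty A = ∃ λ φ → φ ∈ A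

module _ (C : Consequence) (K : Pred Form 0ℓ) where

  record Standard (_≼c_ : RelC) : Set where
    _≃c_ : RelC
    A ≃c B = (A ≼c B) × (B ≼c A)
    _≺c_ : RelC
    A ≺c B = (A ≼c B) × ¬ (B ≼c A)
    field
      transitivity     : ∀ A B D → A ≼c B → B ≼c D → A ≼c D
      weakCoupling     : ∀ A B D → A ≃c conj A B → A ≃c conj A D →
                         A ≃c conj (conj A B) D
      coupling         : ∀ A B → A ≃c B → A ≃c conj A B
      counterDominance : ∀ A B →
                         (∀ φ → φ ∈ B → ∃ λ ψ → ψ ∈ A × _⊢₁_ C φ ψ) → A ≼c B
      minimality       : ∀ A → (∀ B → A ≼c B) ⇔ (∃ λ φ → φ ∈ A × K φ)
      maximality       : ∀ B → NonEmpty B → (∀ A → NonEmpty A → A ≼c B) →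
                         _≡ₛ_ C B (⊥' ∷ [])
      completeness     : ∀ A B → (A ≼c B) ⊎ (B ≼c A)
      determination    : ∀ A → NonEmpty A → A ≺c []
      union            : ∀ A B → (A ≼c (A ++ B)) ⊎ (B ≼c (A ++ B))

lift : Rel₁ → RelC
lift _≼_ A B = (B ≡ []) ⊎ (∃ λ φ → φ ∈ A × All (φ ≼_) B)

restrict : RelC → Rel₁
restrict _≼c_ φ ψ = (φ ∷ []) ≼c (ψ ∷ [])

module Submission where

-- Lifting a total preorder ≼ to finite sets compares sets through their ≼-least
-- elements: if m is least in a non-empty A, then A ≼c B holds iff m ≼ ψ for all
-- ψ ∈ B. Every axiom of a standard multi-believability relation thereby reduces to
-- the corresponding axiom of ≼ applied to least elements. Conversely, union yields
-- in every non-empty A an element φ with {φ} ≼c A, and also A ≼c B as soon as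
-- A ≼c {ψ} for every ψ ∈ B; together these recover ≼c from its singletons.

open import Defs
open import Level using (0ℓ)
open import Data.Bool using (true; _∧_)
open import Data.Bool.Properties using (∧-assoc; ∧-conicalˡ; ∧-conicalʳ)
open import Data.Empty using (⊥-elim)
open import Data.List using (List; []; _∷_; [_]; map; _++_; cartesianProductWith)
open import Data.List.Membership.Propositional using (_∈_)
open import Data.List.Membership.Propositional.Properties
  using (∈-cartesianProductWith⁺; ∈-cartesianProductWith⁻)
open import Data.List.Relation.Unary.Any using (here; there)
open import Data.List.Relation.Unary.All as All using (All; []; _∷_; lookup; tabulate)
open import Data.List.Relation.Unary.All.Properties using (++⁺)
open import Data.Product using (_×_; _,_; proj₁; proj₂; ∃; ∃₂)
open import Data.Sum using (_⊎_; inj₁; inj₂; [_,_]′)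
open import Function using (id)
open import Function.Bundles using (_⇔_; mk⇔; Equivalence)
open import Relation.Binary.Definitions using (Reflexive; Transitive; Total)
open import Relation.Binary.PropositionalEquality
  using (_≡_; refl; sym; trans; cong; cong₂; subst)
open import Relation.Nullary using (¬_)
open import Relation.Unary using (Pred; ｛_｝)

open Equivalence using (to; from)

conj≡cartesianProductWith : ∀ A B → conj A B ≡ cartesianProductWith _∧'_ A B
conj≡cartesianProductWith []      B = refl
conj≡cartesianProductWith (φ ∷ A) B =
  cong (map (φ ∧'_) B ++_) (conj≡cartesianProductWith A B)

∈-conj⁺ : ∀ {A B φ ψ} → φ ∈ A → ψ ∈ B → φ ∧' ψ ∈ conj A B
∈-conj⁺ {A} {B} φ∈A ψ∈B =
  subst (_ ∈_) (sym (conj≡cartesianProductWith A B)) (∈-cartesianProductWith⁺ _∧'_ φ∈A ψ∈B)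

∈-conj⁻ : ∀ A B {χ} → χ ∈ conj A B → ∃₂ λ φ ψ → φ ∈ A × ψ ∈ B × χ ≡ φ ∧' ψ
∈-conj⁻ A B χ∈ = ∈-cartesianProductWith⁻ _∧'_ A B (subst (_ ∈_) (conj≡cartesianProductWith A B) χ∈)

[]≈ₛ⇒≡[] : ∀ {B} → [] ≈ₛ B → B ≡ []
[]≈ₛ⇒≡[] {[]}    _    = refl
[]≈ₛ⇒≡[] {φ ∷ _} []≈B with from ([]≈B φ) (here refl)
... | ()

module Entailment (C : Consequence) where
  open Consequence C

  ⊨⇒⊢₁ : ∀ {φ ψ} → (∀ v → eval v φ ≡ true → eval v ψ ≡ true) → _⊢₁_ C φ ψ
  ⊨⇒⊢₁ {φ} {ψ} φ⊨ψ = supraclassical ｛ φ ｝ ψ (λ v v⊨φ → φ⊨ψ v (v⊨φ φ refl))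

  ⊢₁-refl : ∀ φ → _⊢₁_ C φ φ
  ⊢₁-refl φ = inclusion ｛ φ ｝ refl

  ⊢₁-trans : ∀ {φ ψ χ} → _⊢₁_ C φ ψ → _⊢₁_ C ψ χ → _⊢₁_ C φ χ
  ⊢₁-trans {φ} {ψ} φ⊢ψ ψ⊢χ =
    iteration ｛ φ ｝ (monotony ｛ ψ ｝ (Cn ｛ φ ｝) (λ { refl → φ⊢ψ }) ψ⊢χ)

  ∧-⊢ˡ : ∀ φ ψ → _⊢₁_ C (φ ∧' ψ) φ
  ∧-⊢ˡ φ ψ = ⊨⇒⊢₁ (λ v → ∧-conicalˡ (eval v φ) (eval v ψ))

  ∧-dropMiddle-⊢ : ∀ φ χ ψ → _⊢₁_ C (φ ∧' (χ ∧' ψ)) (φ ∧' ψ)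
  ∧-dropMiddle-⊢ φ χ ψ = ⊨⇒⊢₁ λ v ⊨φχψ →
    cong₂ _∧_ (∧-conicalˡ (eval v φ) _ ⊨φχψ)
              (∧-conicalʳ (eval v χ) (eval v ψ) (∧-conicalʳ (eval v φ) _ ⊨φχψ))

  ∧-assoc-≡ₗ : ∀ φ ψ χ → _≡ₗ_ C ((φ ∧' ψ) ∧' χ) (φ ∧' (ψ ∧' χ))
  ∧-assoc-≡ₗ φ ψ χ =
    ⊨⇒⊢₁ (λ v → trans (sym (∧-assoc (eval v φ) (eval v ψ) (eval v χ)))) ,
    ⊨⇒⊢₁ (λ v → trans (∧-assoc (eval v φ) (eval v ψ) (eval v χ)))

  infix 4 _⊢ₛ_

  _⊢ₛ_ : List Form → List Form → Set
  B ⊢ₛ A = ∀ φ → φ ∈ B → ∃ λ ψ → ψ ∈ A × _⊢₁_ C φ ψ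

  ⊢ₛ-refl : ∀ A → A ⊢ₛ A
  ⊢ₛ-refl A φ φ∈A = φ , φ∈A , ⊢₁-refl φ

  [_]⊢ₛ : ∀ {φ ψ A} → _⊢₁_ C φ ψ → ψ ∈ A → [ φ ] ⊢ₛ A
  [ φ⊢ψ ]⊢ₛ ψ∈A _ (here refl) = _ , ψ∈A , φ⊢ψ

  conj-⊢ₛ : ∀ {A B} D → B ⊢ₛ A → conj B D ⊢ₛ A
  conj-⊢ₛ {B = B} D B⊢A χ χ∈ with ∈-conj⁻ B D χ∈
  ... | φ , ψ , φ∈B , _ , refl with B⊢A φ φ∈B
  ...   | α , α∈A , φ⊢α = α , α∈A , ⊢₁-trans (∧-⊢ˡ φ ψ) φ⊢α

module LeastElement {A : Set} {_≼_ : A → A → Set}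
                    (≼-trans : Transitive _≼_) (≼-total : Total _≼_) where

  ≼-refl : Reflexive _≼_
  ≼-refl {x} = [ id , id ]′ (≼-total x x)

  least : ∀ x xs → ∃ λ m → m ∈ x ∷ xs × All (m ≼_) (x ∷ xs)
  least x [] = x , here refl , ≼-refl ∷ []
  least x (y ∷ ys) with least y ys
  ... | m , m∈ , m≼ with ≼-total x m
  ...   | inj₁ x≼m = x , here refl , ≼-refl ∷ All.map (≼-trans x≼m) m≼
  ...   | inj₂ m≼x = m , there m∈ , m≼x ∷ m≼

module Lift (C : Consequence) (K : Pred Form 0ℓ) {_≼_ : Rel₁} (Q : QuasiLinear C K _≼_) where
  open QuasiLinear Q
  open Entailment C

  ≼-trans : Transitive _≼_
  ≼-trans = transitivity _ _ _

  open LeastElement ≼-trans completeness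

  _≼c_ : RelC
  _≼c_ = lift _≼_

  ⊢⇒≽ : ∀ {φ ψ} → _⊢₁_ C φ ψ → ψ ≼ φ
  ⊢⇒≽ = counterDominance _ _

  ¬[]≼c∷ : ∀ {φ B} → ¬ ([] ≼c (φ ∷ B))
  ¬[]≼c∷ (inj₁ ())
  ¬[]≼c∷ (inj₂ (_ , () , _))

  lowerBound-≼c : ∀ {m A B} → All (m ≼_) A → A ≼c B → All (m ≼_) B
  lowerBound-≼c m≼A (inj₁ refl)            = []
  lowerBound-≼c m≼A (inj₂ (φ , φ∈ , φ≼B)) = All.map (≼-trans (lookup m≼A φ∈)) φ≼B

  lowerBound-⊢ₛ : ∀ {m A B} → All (m ≼_) A → B ⊢ₛ A → All (m ≼_) B
  lowerBound-⊢ₛ m≼A B⊢A = tabulate λ {φ} φ∈ →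
    let ψ , ψ∈ , φ⊢ψ = B⊢A φ φ∈ in ≼-trans (lookup m≼A ψ∈) (⊢⇒≽ φ⊢ψ)

  ≼c-refl : ∀ A → A ≼c A
  ≼c-refl []       = inj₁ refl
  ≼c-refl (x ∷ xs) = inj₂ (least x xs)

  ≼c-trans : ∀ A B D → A ≼c B → B ≼c D → A ≼c D
  ≼c-trans _ _ _ (inj₁ refl) (inj₁ refl)        = inj₁ refl
  ≼c-trans _ _ _ (inj₁ refl) (inj₂ (_ , () , _))
  ≼c-trans _ _ _ (inj₂ (φ , φ∈ , φ≼B)) B≼D     = inj₂ (φ , φ∈ , lowerBound-≼c φ≼B B≼D)

  ≼c-counterDominance : ∀ A B → B ⊢ₛ A → A ≼c B
  ≼c-counterDominance _ [] _ = inj₁ refl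
  ≼c-counterDominance [] (φ ∷ _) B⊢A with B⊢A φ (here refl)
  ... | _ , () , _
  ≼c-counterDominance (x ∷ xs) B B⊢A =
    let m , m∈ , m≼A = least x xs in inj₂ (m , m∈ , lowerBound-⊢ₛ m≼A B⊢A)

  ≼c-minimality : ∀ A → (∀ B → A ≼c B) ⇔ (∃ λ φ → φ ∈ A × K φ)
  ≼c-minimality A = mk⇔ (least-in-K A)
    (λ (φ , φ∈ , Kφ) B → inj₂ (φ , φ∈ , tabulate λ _ → to (minimality φ) Kφ _))
    where
    least-in-K : ∀ A → (∀ B → A ≼c B) → ∃ λ φ → φ ∈ A × K φ
    least-in-K []       A≼ = ⊥-elim (¬[]≼c∷ (A≼ [ ⊥' ]))
    least-in-K (x ∷ xs) A≼ =
      let m , m∈ , m≼A = least x xs in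
      m , m∈ , from (minimality m) λ ψ → lookup (lowerBound-≼c m≼A (A≼ [ ψ ])) (here refl)

  ≼c-maximality : ∀ B → NonEmpty B → (∀ A → NonEmpty A → A ≼c B) → _≡ₛ_ C B [ ⊥' ]
  ≼c-maximality B (β , β∈) ≼B =
    (λ φ φ∈ → ⊥' , here refl , ≡⊥ φ∈) , λ { _ (here refl) → β , β∈ , ≡⊥ β∈ }
    where
    ≡⊥ : ∀ {φ} → φ ∈ B → _≡ₗ_ C φ ⊥'
    ≡⊥ φ∈ = maximality _ λ ψ → lookup (lowerBound-≼c (≼-refl ∷ []) (≼B [ ψ ] (ψ , here refl))) φ∈

  ≼c-total : ∀ A B → A ≼c B ⊎ B ≼c A
  ≼c-total []       _        = inj₂ (inj₁ refl)
  ≼c-total _        []       = inj₁ (inj₁ refl)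
  ≼c-total (x ∷ xs) (y ∷ ys) with least x xs | least y ys
  ... | a , a∈ , a≼A | b , b∈ , b≼B with completeness a b
  ...   | inj₁ a≼b = inj₁ (inj₂ (a , a∈ , All.map (≼-trans a≼b) b≼B))
  ...   | inj₂ b≼a = inj₂ (inj₂ (b , b∈ , All.map (≼-trans b≼a) a≼A))

  ≼c-determination : ∀ A → NonEmpty A → A ≼c [] × ¬ ([] ≼c A)
  ≼c-determination []      (_ , ())
  ≼c-determination (_ ∷ _) _ = inj₁ refl , ¬[]≼c∷

  ≼c-++ : ∀ A B D → A ≼c B → A ≼c D → A ≼c (B ++ D)
  ≼c-++ []       []      _ _   A≼D = A≼D
  ≼c-++ []       (_ ∷ _) _ A≼B _   = ⊥-elim (¬[]≼c∷ A≼B)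
  ≼c-++ (x ∷ xs) _       _ A≼B A≼D =
    let m , m∈ , m≼A = least x xs in
    inj₂ (m , m∈ , ++⁺ (lowerBound-≼c m≼A A≼B) (lowerBound-≼c m≼A A≼D))

  ≼c-union : ∀ A B → A ≼c (A ++ B) ⊎ B ≼c (A ++ B)
  ≼c-union A B with ≼c-total A B
  ... | inj₁ A≼B = inj₁ (≼c-++ A A B (≼c-refl A) A≼B)
  ... | inj₂ B≼A = inj₂ (≼c-++ B A B B≼A (≼c-refl B))

  ≼c-conj : ∀ A B → A ≼c conj A B
  ≼c-conj A B = ≼c-counterDominance A (conj A B) (conj-⊢ₛ B (⊢ₛ-refl A))

  ≼c-conj² : ∀ A B D → A ≼c conj (conj A B) D
  ≼c-conj² A B D = ≼c-counterDominance A _ (conj-⊢ₛ D (conj-⊢ₛ B (⊢ₛ-refl A)))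

  conj-≼c : ∀ A B → A ≼c B → B ≼c A → conj A B ≼c A
  conj-≼c []       _ _   _                        = inj₁ refl
  conj-≼c (_ ∷ _)  _ _   (inj₁ ())
  conj-≼c (x ∷ xs) _ A≼B (inj₂ (β , β∈ , β≼A)) =
    let m , m∈ , m≼A = least x xs
        m≃β = lookup (lowerBound-≼c m≼A A≼B) β∈ , lookup β≼A m∈
    in inj₂ (m ∧' β , ∈-conj⁺ m∈ β∈ , All.map (≼-trans (proj₂ (coupling m β m≃β))) m≼A)

  conj-≼c-witness : ∀ {m} A B → m ∈ A → All (m ≼_) A → conj A B ≼c A →
                    ∃ λ ψ → ψ ∈ B × m ≃ (m ∧' ψ)
  conj-≼c-witness _ _ () _ (inj₁ refl)
  conj-≼c-witness A B m∈ m≼A (inj₂ (χ , χ∈ , χ≼A)) with ∈-conj⁻ A B χ∈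
  ... | φ , ψ , _ , ψ∈ , refl =
    let m≃χ = lookup (lowerBound-≼c m≼A (≼c-conj A B)) χ∈ , lookup χ≼A m∈ in
    ψ , ψ∈ , ⊢⇒≽ (∧-⊢ˡ _ ψ) ,
    ≼-trans (⊢⇒≽ (∧-dropMiddle-⊢ _ φ ψ)) (proj₂ (coupling _ _ m≃χ))

  conj²-≼c : ∀ A B D → conj A B ≼c A → conj A D ≼c A → conj (conj A B) D ≼c A
  conj²-≼c []       _ _ _     _     = inj₁ refl
  conj²-≼c (x ∷ xs) B D AB≼A AD≼A =
    let m , m∈ , m≼A     = least x xs
        ψ , ψ∈ , m≃m∧ψ   = conj-≼c-witness _ B m∈ m≼A AB≼A
        χ , χ∈ , m≃m∧χ   = conj-≼c-witness _ D m∈ m≼A AD≼A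
        m∧[ψ∧χ]≼m         = proj₂ (weakCoupling m ψ χ m≃m∧ψ m≃m∧χ)
        [m∧ψ]∧χ≼m         = ≼-trans (⊢⇒≽ (proj₂ (∧-assoc-≡ₗ m ψ χ))) m∧[ψ∧χ]≼m
    in inj₂ ((m ∧' ψ) ∧' χ , ∈-conj⁺ (∈-conj⁺ m∈ ψ∈) χ∈ , All.map (≼-trans [m∧ψ]∧χ≼m) m≼A)

  ≼c-onFiniteSets : OnFiniteSets _≼c_
  ≼c-onFiniteSets _ _ _ _ _     B≈B' (inj₁ refl)           = inj₁ ([]≈ₛ⇒≡[] B≈B')
  ≼c-onFiniteSets _ _ _ _ A≈A' B≈B' (inj₂ (φ , φ∈ , φ≼B)) =
    inj₂ (φ , to (A≈A' φ) φ∈ , tabulate λ ψ∈ → lookup φ≼B (from (B≈B' _) ψ∈))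

  ≼c-standard : Standard C K _≼c_
  ≼c-standard = record
    { transitivity     = ≼c-trans
    ; weakCoupling     = λ A B D (_ , AB≼A) (_ , AD≼A) → ≼c-conj² A B D , conj²-≼c A B D AB≼A AD≼A
    ; coupling         = λ A B (A≼B , B≼A) → ≼c-conj A B , conj-≼c A B A≼B B≼A
    ; counterDominance = ≼c-counterDominance
    ; minimality       = ≼c-minimality
    ; maximality       = ≼c-maximality
    ; completeness     = ≼c-total
    ; determination    = ≼c-determination
    ; union            = ≼c-union
    }

  ≼⇔restrict-≼c : ∀ φ ψ → (φ ≼ ψ) ⇔ restrict _≼c_ φ ψ
  ≼⇔restrict-≼c φ ψ = mk⇔ (λ φ≼ψ → inj₂ (φ , here refl , φ≼ψ ∷ []))
    λ { (inj₁ ()) ; (inj₂ (_ , here refl , φ≼ψ ∷ [])) → φ≼ψ }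

module Restrict (C : Consequence) (K : Pred Form 0ℓ) {_≼c_ : RelC} (S : Standard C K _≼c_) where
  open Standard S
  open Entailment C

  _≼_ : Rel₁
  _≼_ = restrict _≼c_

  ≼c-trans : ∀ {A B D} → A ≼c B → B ≼c D → A ≼c D
  ≼c-trans = transitivity _ _ _

  ≼c-refl : ∀ A → A ≼c A
  ≼c-refl A = [ id , id ]′ (completeness A A)

  ⊢⇒≽ : ∀ {φ ψ} → _⊢₁_ C φ ψ → ψ ≼ φ
  ⊢⇒≽ φ⊢ψ = counterDominance _ _ ([ φ⊢ψ ]⊢ₛ (here refl))

  ≼c-[] : ∀ A → A ≼c []
  ≼c-[] []       = ≼c-refl []
  ≼c-[] (x ∷ xs) = proj₁ (determination (x ∷ xs) (x , here refl))

  ≼c-∈ : ∀ {φ A} → φ ∈ A → A ≼c [ φ ]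
  ≼c-∈ {φ} φ∈A = counterDominance _ _ ([ ⊢₁-refl φ ]⊢ₛ φ∈A)

  least : ∀ x xs → ∃ λ φ → φ ∈ x ∷ xs × [ φ ] ≼c (x ∷ xs)
  least x []       = x , here refl , ≼c-refl _
  least x (y ∷ ys) with union [ x ] (y ∷ ys)
  ... | inj₁ x≼ = x , here refl , x≼
  ... | inj₂ ys≼ = let φ , φ∈ , φ≼ = least y ys in φ , there φ∈ , ≼c-trans φ≼ ys≼

  ≼c-fromSingletons : ∀ A {B} → All (λ ψ → A ≼c [ ψ ]) B → A ≼c B
  ≼c-fromSingletons A []                      = ≼c-[] A
  ≼c-fromSingletons A {ψ ∷ B} (A≼ψ ∷ A≼B) with union [ ψ ] B
  ... | inj₁ ψ≼ = ≼c-trans A≼ψ ψ≼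
  ... | inj₂ B≼ = ≼c-trans (≼c-fromSingletons A A≼B) B≼

  ≼c⇒lift : ∀ A B → A ≼c B → lift _≼_ A B
  ≼c⇒lift _        []      _   = inj₁ refl
  ≼c⇒lift []       (ψ ∷ B) []≼ = ⊥-elim (proj₂ (determination (ψ ∷ B) (ψ , here refl)) []≼)
  ≼c⇒lift (x ∷ xs) B       A≼B =
    let φ , φ∈ , φ≼A = least x xs in
    inj₂ (φ , φ∈ , tabulate λ ψ∈ → ≼c-trans φ≼A (≼c-trans A≼B (≼c-∈ ψ∈)))

  lift⇒≼c : ∀ A B → lift _≼_ A B → A ≼c B
  lift⇒≼c A _ (inj₁ refl)            = ≼c-[] A
  lift⇒≼c _ _ (inj₂ (φ , φ∈ , φ≼B)) = ≼c-trans (≼c-∈ φ∈) (≼c-fromSingletons [ φ ] φ≼B)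

  ≼c⇔lift : ∀ A B → (A ≼c B) ⇔ lift _≼_ A B
  ≼c⇔lift A B = mk⇔ (≼c⇒lift A B) (lift⇒≼c A B)

  ≼-minimality : ∀ φ → K φ ⇔ (∀ ψ → φ ≼ ψ)
  ≼-minimality φ = mk⇔
    (λ Kφ ψ → from (minimality [ φ ]) (φ , here refl , Kφ) [ ψ ])
    (λ φ≼ → in-K (to (minimality [ φ ]) λ _ → ≼c-fromSingletons [ φ ] (tabulate λ _ → φ≼ _)))
    where
    in-K : (∃ λ χ → χ ∈ [ φ ] × K χ) → K φ
    in-K (_ , here refl , Kφ) = Kφ

  ≼-maximality : ∀ φ → (∀ ψ → ψ ≼ φ) → _≡ₗ_ C φ ⊥'
  ≼-maximality φ ≼φ
    with proj₁ (maximality [ φ ] (φ , here refl) λ _ (ψ , ψ∈) → ≼c-trans (≼c-∈ ψ∈) (≼φ ψ)) φ (here refl)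
  ... | _ , here refl , φ≡ₗ⊥ = φ≡ₗ⊥

  ≼-quasiLinear : QuasiLinear C K _≼_
  ≼-quasiLinear = record
    { transitivity     = λ _ _ _ → ≼c-trans
    ; coupling         = λ φ ψ → coupling [ φ ] [ ψ ]
    ; weakCoupling     = λ φ ψ χ φ≃φ∧ψ φ≃φ∧χ →
        let _ , [φ∧ψ]∧χ≼φ = weakCoupling [ φ ] [ ψ ] [ χ ] φ≃φ∧ψ φ≃φ∧χ in
        ⊢⇒≽ (∧-⊢ˡ φ (ψ ∧' χ)) , ≼c-trans (⊢⇒≽ (proj₁ (∧-assoc-≡ₗ φ ψ χ))) [φ∧ψ]∧χ≼φ
    ; counterDominance = λ _ _ → ⊢⇒≽
    ; minimality       = ≼-minimality
    ; maximality       = ≼-maximality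
    ; completeness     = λ _ _ → completeness _ _
    }

theorem3 : (C : Consequence) (K : Pred Form 0ℓ) → ConsistentBeliefSet C K →
    ((_≼_ : Rel₁) → QuasiLinear C K _≼_ →
      (Standard C K (lift _≼_) × OnFiniteSets (lift _≼_))
      × (∀ φ ψ → (φ ≼ ψ) ⇔ restrict (lift _≼_) φ ψ))
    × ((_≼c_ : RelC) → OnFiniteSets _≼c_ → Standard C K _≼c_ →
      QuasiLinear C K (restrict _≼c_)
      × (∀ A B → (A ≼c B) ⇔ lift (restrict _≼c_) A B))
theorem3 C K _ =
  (λ _ Q → (Lift.≼c-standard C K Q , Lift.≼c-onFiniteSets C K Q) , Lift.≼⇔restrict-≼c C K Q) ,
  (λ _ _ S → Restrict.≼-quasiLinear C K S , Restrict.≼c⇔lift C K S)
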